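{- Let $Q$ be a commutative involutive quantale and $A,B$ sets. Suppose $\mathbf{A}\subseteq\mathrm{Hom}(A,A)$ is an object of $\mathbf{Rel}_Q\text{ - }\mathbf{Alg}_{\mathrm{vN}}(A)$ and $\mathbf{B}\subseteq\mathrm{Hom}(B,B)$ is an object of $\mathbf{Rel}_Q\text{ - }\mathbf{Alg}_{\mathrm{vN}}(B)$. Then $\mathbf{A}\oplus\mathbf{B}\subseteq\mathrm{Hom}(A\sqcup B,A\sqcup B)$ is an object of $\mathbf{Rel}_Q\text{ - }\mathbf{Alg}_{\mathrm{vN}}(A\sqcup B)$.
   Context: A commutative involutive quantale $Q$ is a complete join-semilattice with a commutative monoid operation $\cdot$ (unit $1_Q$) distributing over arbitrary joins, and a join-preserving involution ${}^*$ with $(xy)^*=y^*x^*$, $1_Q^*=1_Q$; its least element is $0\neq\top$. In $\mathbf{Rel}_Q$, objects are sets, morphisms $X\to Y$ are functions $X\times Y\to Q$, composition $(g\circ f)(x,z)=\bigvee_y f(x,y)g(y,z)$, identities $\mathrm{id}_X(x,y)=1_Q$ iff $x=y$ (else $0$), dagger $f^\dagger(y,x)=f(x,y)^*$, scalar multiplication pointwise. $\mathbf{Rel}_Q\text{ - }\mathbf{Alg}_{\mathrm{vN}}(X)$ has as objects the subsets $\mathbf{C}\subseteq\mathrm{Hom}(X,X)$ containing the zero map and $\mathrm{id}_X$, closed under binary pointwise joins, composition, scalar multiplication and $\dagger$, commutative under composition, and satisfying $\mathbf{C}=\mathbf{C}''$, where $D'=\{f:f\circ g=g\circ f\ \forall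 g\in D\}$. $\mathbf{A}\oplus\mathbf{B}$ denotes the set of block-diagonal relations $f\oplus g$ on $A\sqcup B$ with $f\in\mathbf{A}$, $g\in\mathbf{B}$, i.e. $(f\oplus g)(u,v)=f(u,v)$ if $u,v\in A$, $=g(u,v)$ if $u,v\in B$, and $0$ otherwise. -}

module Defs where

open import Data.Bool using (Bool; true; false)
open import Data.Empty using (⊥)
open import Data.Product using (Σ; _×_; _,_)
open import Data.Sum using (_⊎_; inj₁; inj₂)
open import Relation.Binary.PropositionalEquality using (_≡_; _≢_)
open import Relation.Binary.Structures using (IsPartialOrder)
open import Algebra.Structures using (IsCommutativeMonoid)
open import Function.Bundles using (_⇔_)

-- A commutative involutive quantale.  "Sets" are types in Set; arbitrary
-- joins are indexed by arbitrary types I : Set.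
record Quantale : Set₁ where
  infixl 7 _·_
  field
    Carrier   : Set
    _≤_       : Carrier → Carrier → Set
    isPartialOrder : IsPartialOrder _≡_ _≤_
    ⋁         : {I : Set} → (I → Carrier) → Carrier
    ⋁-upper   : ∀ {I : Set} (f : I → Carrier) (i : I) → f i ≤ ⋁ f
    ⋁-least   : ∀ {I : Set} (f : I → Carrier) (x : Carrier) →
                (∀ i → f i ≤ x) → ⋁ f ≤ x
    _·_       : Carrier → Carrier → Carrier
    1Q        : Carrier
    isCommutativeMonoid : IsCommutativeMonoid _≡_ _·_ 1Q
    ·-distrib-⋁ : ∀ (x : Carrier) {I : Set} (f : I → Carrier) →
                  x · ⋁ f ≡ ⋁ (λ i → x · f i)
    _*        : Carrier → Carrier
    *-⋁       : ∀ {I : Set} (f : I → Carrier) → (⋁ f) * ≡ ⋁ (λ i → (f i) *)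
    *-involutive : ∀ x → (x *) * ≡ x
    *-anti    : ∀ x y → (x · y) * ≡ (y *) · (x *)
    *-unit    : 1Q * ≡ 1Q

  0Q : Carrier
  0Q = ⋁ {⊥} (λ ())

  ⊤Q : Carrier
  ⊤Q = ⋁ {Carrier} (λ x → x)

  _∨_ : Carrier → Carrier → Carrier
  x ∨ y = ⋁ {Bool} (λ { true → x ; false → y })

  field
    0≢⊤ : 0Q ≢ ⊤Q

module RelQ (Q : Quantale) where
  open Quantale Q

  Hom : Set → Set → Set
  Hom X Y = X → Y → Carrier

  _≐_ : {X Y : Set} → Hom X Y → Hom X Y → Set
  f ≐ g = ∀ x y → f x y ≡ g x y

  _∘R_ : {X Y Z : Set} → Hom Y Z → Hom X Y → Hom X Z
  (g ∘R f) x z = ⋁ (λ y → f x y · g y z)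

  -- id x y = 1 if x = y, 0 otherwise (written as the join of 1 over proofs of x ≡ y)
  idR : (X : Set) → Hom X X
  idR X x y = ⋁ {x ≡ y} (λ _ → 1Q)

  zeroR : {X Y : Set} → Hom X Y
  zeroR x y = 0Q

  _∨R_ : {X Y : Set} → Hom X Y → Hom X Y → Hom X Y
  (f ∨R g) x y = f x y ∨ g x y

  _⊙_ : {X Y : Set} → Carrier → Hom X Y → Hom X Y
  (q ⊙ f) x y = q · f x y

  _† : {X Y : Set} → Hom X Y → Hom Y X
  (f †) y x = (f x y) *

  Subset : Set → Set₁
  Subset X = Hom X X → Set

  _′ : {X : Set} → Subset X → Subset X
  (D ′) f = ∀ g → D g → (f ∘R g) ≐ (g ∘R f)

  record IsVNAlg (X : Set) (C : Subset X) : Set₁ where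
    field
      has-zero : C zeroR
      has-id   : C (idR X)
      ∨-closed : ∀ f g → C f → C g → C (f ∨R g)
      ∘-closed : ∀ f g → C f → C g → C (g ∘R f)
      ⊙-closed : ∀ q f → C f → C (q ⊙ f)
      †-closed : ∀ f → C f → C (f †)
      commutative : ∀ f g → C f → C g → (g ∘R f) ≐ (f ∘R g)
      bicommutant : ∀ f → C f ⇔ ((C ′) ′) f

  _⊕R_ : {A B : Set} → Hom A A → Hom B B → Hom (A ⊎ B) (A ⊎ B)
  (f ⊕R g) (inj₁ a) (inj₁ a′) = f a a′
  (f ⊕R g) (inj₂ b) (inj₂ b′) = g b b′
  (f ⊕R g) (inj₁ a) (inj₂ b)  = 0Q
  (f ⊕R g) (inj₂ b) (inj₁ a)  = 0Q

  _⊕S_ : {A B : Set} → Subset A → Subset B → Subset (A ⊎ B)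
  (𝐀 ⊕S 𝐁) h = Σ _ λ f → Σ _ λ g → 𝐀 f × 𝐁 g × (h ≐ (f ⊕R g))

-- A relation on A ⊎ B commuting with the idempotent projA = id ⊕ 0 is block diagonal,
-- and block-diagonal relations commute iff their blocks do.  Since 𝐀 ⊕ 𝐁 contains projA
-- and every f ⊕ 0, 0 ⊕ g, this gives (𝐀 ⊕ 𝐁)′ = 𝐀′ ⊕ 𝐁′; applied once more (𝐀′ and 𝐁′
-- contain id and 0) it gives (𝐀 ⊕ 𝐁)″ = 𝐀″ ⊕ 𝐁″ = 𝐀 ⊕ 𝐁.  The remaining closure
-- properties hold blockwise because composition, joins, scalars and † act blockwise.
module Submission where

open import Defs
open import Data.Sum using (_⊎_; inj₁; inj₂)
open import Data.Sum.Properties using (inj₁-injective; inj₂-injective)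
open import Data.Bool using (true; false)
open import Data.Product using (_×_; _,_; proj₁; proj₂)
open import Relation.Binary.PropositionalEquality
  using (_≡_; refl; sym; trans; cong; cong₂; module ≡-Reasoning)
open import Relation.Binary.Structures using (IsPartialOrder)
open import Algebra.Structures using (IsCommutativeMonoid)
open import Function.Bundles using (_⇔_; mk⇔; Equivalence)
open import Function.Construct.Composition using (_⇔-∘_)
open import Function.Construct.Symmetry using (⇔-sym)

module QuantaleProperties (Q : Quantale) where
  open Quantale Q
  open IsPartialOrder isPartialOrder
    using (antisym; reflexive) renaming (refl to ≤-refl; trans to ≤-trans)
  open IsCommutativeMonoid isCommutativeMonoid using (comm)

  ⋁-cong : ∀ {I : Set} {f g : I → Carrier} → (∀ i → f i ≡ g i) → ⋁ f ≡ ⋁ g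
  ⋁-cong {f = f} {g} f≡g = antisym
    (⋁-least f (⋁ g) λ i → ≤-trans (reflexive (f≡g i)) (⋁-upper g i))
    (⋁-least g (⋁ f) λ i → ≤-trans (reflexive (sym (f≡g i))) (⋁-upper f i))

  0≤ : ∀ x → 0Q ≤ x
  0≤ x = ⋁-least _ x (λ ())

  ⋁-zero : ∀ {I : Set} (f : I → Carrier) → (∀ i → f i ≡ 0Q) → ⋁ f ≡ 0Q
  ⋁-zero f f≡0 = antisym (⋁-least f 0Q (λ i → reflexive (f≡0 i))) (0≤ _)

  ·-zeroʳ : ∀ x → x · 0Q ≡ 0Q
  ·-zeroʳ x = trans (·-distrib-⋁ x _) (⋁-zero _ (λ ()))

  ·-zeroˡ : ∀ x → 0Q · x ≡ 0Q
  ·-zeroˡ x = trans (comm 0Q x) (·-zeroʳ x)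

  ·-distribʳ-⋁ : ∀ (x : Carrier) {I : Set} (f : I → Carrier) → ⋁ f · x ≡ ⋁ (λ i → f i · x)
  ·-distribʳ-⋁ x f =
    trans (comm _ x) (trans (·-distrib-⋁ x f) (⋁-cong λ i → comm x (f i)))

  *-zero : 0Q * ≡ 0Q
  *-zero = trans (*-⋁ _) (⋁-zero _ (λ ()))

  ∨-zero : 0Q ∨ 0Q ≡ 0Q
  ∨-zero = ⋁-zero _ (λ { true → refl ; false → refl })

  ⋁-inj₁ : ∀ {A B : Set} (f : A ⊎ B → Carrier) → (∀ b → f (inj₂ b) ≡ 0Q) →
           ⋁ f ≡ ⋁ (λ a → f (inj₁ a))
  ⋁-inj₁ f f₂≡0 = antisym
    (⋁-least f _ λ { (inj₁ a) → ⋁-upper (λ a → f (inj₁ a)) a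
                   ; (inj₂ b) → ≤-trans (reflexive (f₂≡0 b)) (0≤ _) })
    (⋁-least _ (⋁ f) λ a → ⋁-upper f (inj₁ a))

  ⋁-inj₂ : ∀ {A B : Set} (f : A ⊎ B → Carrier) → (∀ a → f (inj₁ a) ≡ 0Q) →
           ⋁ f ≡ ⋁ (λ b → f (inj₂ b))
  ⋁-inj₂ f f₁≡0 = antisym
    (⋁-least f _ λ { (inj₁ a) → ≤-trans (reflexive (f₁≡0 a)) (0≤ _)
                   ; (inj₂ b) → ⋁-upper (λ b → f (inj₂ b)) b })
    (⋁-least _ (⋁ f) λ b → ⋁-upper f (inj₂ b))

  ⋁-const-⇔ : ∀ {I J : Set} c → (I → J) → (J → I) → ⋁ {I} (λ _ → c) ≡ ⋁ {J} (λ _ → c)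
  ⋁-const-⇔ c i→j j→i = antisym
    (⋁-least _ _ λ i → ⋁-upper _ (i→j i))
    (⋁-least _ _ λ j → ⋁-upper _ (j→i j))

  ⋁-singletonˡ : ∀ {X : Set} (h : X → Carrier) x → ⋁ (λ y → ⋁ {x ≡ y} (λ _ → h y)) ≡ h x
  ⋁-singletonˡ h x = antisym
    (⋁-least _ _ λ y → ⋁-least _ _ λ { refl → ≤-refl })
    (≤-trans (⋁-upper (λ _ → h x) refl) (⋁-upper _ x))

  ⋁-singletonʳ : ∀ {X : Set} (h : X → Carrier) z → ⋁ (λ y → ⋁ {y ≡ z} (λ _ → h y)) ≡ h z
  ⋁-singletonʳ h z = antisym
    (⋁-least _ _ λ y → ⋁-least _ _ λ { refl → ≤-refl })
    (≤-trans (⋁-upper (λ _ → h z) refl) (⋁-upper _ z))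

module RelationProperties (Q : Quantale) where
  open Quantale Q
  open RelQ Q
  open QuantaleProperties Q
  open IsCommutativeMonoid isCommutativeMonoid using (identityˡ; identityʳ)
  open ≡-Reasoning

  ≐-sym : ∀ {X Y : Set} {f g : Hom X Y} → f ≐ g → g ≐ f
  ≐-sym f≐g x y = sym (f≐g x y)

  ≐-trans : ∀ {X Y : Set} {f g h : Hom X Y} → f ≐ g → g ≐ h → f ≐ h
  ≐-trans f≐g g≐h x y = trans (f≐g x y) (g≐h x y)

  ∘R-cong : ∀ {X : Set} {f f′ g g′ : Hom X X} → f ≐ f′ → g ≐ g′ → (g ∘R f) ≐ (g′ ∘R f′)
  ∘R-cong f≐f′ g≐g′ x z = ⋁-cong (λ y → cong₂ _·_ (f≐f′ x y) (g≐g′ y z))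

  ∨R-cong : ∀ {X : Set} {f f′ g g′ : Hom X X} → f ≐ f′ → g ≐ g′ → (f ∨R g) ≐ (f′ ∨R g′)
  ∨R-cong f≐f′ g≐g′ x y = cong₂ _∨_ (f≐f′ x y) (g≐g′ x y)

  ⊙-cong : ∀ {X : Set} q {f f′ : Hom X X} → f ≐ f′ → (q ⊙ f) ≐ (q ⊙ f′)
  ⊙-cong q f≐f′ x y = cong (q ·_) (f≐f′ x y)

  †-cong : ∀ {X : Set} {f f′ : Hom X X} → f ≐ f′ → (f †) ≐ (f′ †)
  †-cong f≐f′ x y = cong _* (f≐f′ y x)

  ⋁-idR-· : ∀ {X : Set} (h : X → Carrier) x → ⋁ (λ y → idR X x y · h y) ≡ h x
  ⋁-idR-· h x = trans
    (⋁-cong λ y → trans (·-distribʳ-⋁ (h y) _) (⋁-cong λ _ → identityˡ (h y)))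
    (⋁-singletonˡ h x)

  ⋁-·-idR : ∀ {X : Set} (h : X → Carrier) z → ⋁ (λ y → h y · idR X y z) ≡ h z
  ⋁-·-idR h z = trans
    (⋁-cong λ y → trans (·-distrib-⋁ (h y) _) (⋁-cong λ _ → identityʳ (h y)))
    (⋁-singletonʳ h z)

  Commute : {X : Set} → Hom X X → Hom X X → Set
  Commute f g = (f ∘R g) ≐ (g ∘R f)

  Commute-resp : ∀ {X : Set} {f f′ g g′ : Hom X X} → f ≐ f′ → g ≐ g′ →
                 Commute f g → Commute f′ g′
  Commute-resp f≐f′ g≐g′ fg =
    ≐-trans (∘R-cong (≐-sym g≐g′) (≐-sym f≐f′)) (≐-trans fg (∘R-cong f≐f′ g≐g′))

  idR-commute : ∀ {X : Set} (g : Hom X X) → Commute (idR X) g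
  idR-commute g x z = trans (⋁-·-idR (g x) z) (sym (⋁-idR-· (λ y → g y z) x))

  zeroR-commute : ∀ {X : Set} (g : Hom X X) → Commute zeroR g
  zeroR-commute g x z = trans (⋁-zero _ λ _ → ·-zeroʳ _) (sym (⋁-zero _ λ _ → ·-zeroˡ _))

  module _ {A B : Set} where

    ⊕R-cong : {f f′ : Hom A A} {g g′ : Hom B B} → f ≐ f′ → g ≐ g′ → (f ⊕R g) ≐ (f′ ⊕R g′)
    ⊕R-cong f≐f′ g≐g′ (inj₁ a) (inj₁ a′) = f≐f′ a a′
    ⊕R-cong f≐f′ g≐g′ (inj₂ b) (inj₂ b′) = g≐g′ b b′
    ⊕R-cong f≐f′ g≐g′ (inj₁ a) (inj₂ b)  = refl
    ⊕R-cong f≐f′ g≐g′ (inj₂ b) (inj₁ a)  = refl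

    ⊕R-zeroR : zeroR ≐ (zeroR {A} ⊕R zeroR {B})
    ⊕R-zeroR (inj₁ a) (inj₁ a′) = refl
    ⊕R-zeroR (inj₂ b) (inj₂ b′) = refl
    ⊕R-zeroR (inj₁ a) (inj₂ b)  = refl
    ⊕R-zeroR (inj₂ b) (inj₁ a)  = refl

    ⊕R-idR : idR (A ⊎ B) ≐ (idR A ⊕R idR B)
    ⊕R-idR (inj₁ a) (inj₁ a′) = ⋁-const-⇔ 1Q inj₁-injective (cong inj₁)
    ⊕R-idR (inj₂ b) (inj₂ b′) = ⋁-const-⇔ 1Q inj₂-injective (cong inj₂)
    ⊕R-idR (inj₁ a) (inj₂ b)  = ⋁-zero _ (λ ())
    ⊕R-idR (inj₂ b) (inj₁ a)  = ⋁-zero _ (λ ())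

    ⊕R-∘R : (f f′ : Hom A A) (g g′ : Hom B B) →
            ((f′ ⊕R g′) ∘R (f ⊕R g)) ≐ ((f′ ∘R f) ⊕R (g′ ∘R g))
    ⊕R-∘R f f′ g g′ (inj₁ a) (inj₁ a′) = ⋁-inj₁ _ (λ _ → ·-zeroʳ 0Q)
    ⊕R-∘R f f′ g g′ (inj₂ b) (inj₂ b′) = ⋁-inj₂ _ (λ _ → ·-zeroʳ 0Q)
    ⊕R-∘R f f′ g g′ (inj₁ a) (inj₂ b)  =
      ⋁-zero _ λ { (inj₁ a′) → ·-zeroʳ (f a a′) ; (inj₂ b′) → ·-zeroˡ (g′ b′ b) }
    ⊕R-∘R f f′ g g′ (inj₂ b) (inj₁ a)  =
      ⋁-zero _ λ { (inj₁ a′) → ·-zeroˡ (f′ a′ a) ; (inj₂ b′) → ·-zeroʳ (g b b′) }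

    ⊕R-∨R : (f f′ : Hom A A) (g g′ : Hom B B) →
            ((f ⊕R g) ∨R (f′ ⊕R g′)) ≐ ((f ∨R f′) ⊕R (g ∨R g′))
    ⊕R-∨R f f′ g g′ (inj₁ a) (inj₁ a′) = refl
    ⊕R-∨R f f′ g g′ (inj₂ b) (inj₂ b′) = refl
    ⊕R-∨R f f′ g g′ (inj₁ a) (inj₂ b)  = ∨-zero
    ⊕R-∨R f f′ g g′ (inj₂ b) (inj₁ a)  = ∨-zero

    ⊕R-⊙ : ∀ q (f : Hom A A) (g : Hom B B) → (q ⊙ (f ⊕R g)) ≐ ((q ⊙ f) ⊕R (q ⊙ g))
    ⊕R-⊙ q f g (inj₁ a) (inj₁ a′) = refl
    ⊕R-⊙ q f g (inj₂ b) (inj₂ b′) = refl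
    ⊕R-⊙ q f g (inj₁ a) (inj₂ b)  = ·-zeroʳ q
    ⊕R-⊙ q f g (inj₂ b) (inj₁ a)  = ·-zeroʳ q

    ⊕R-† : (f : Hom A A) (g : Hom B B) → ((f ⊕R g) †) ≐ ((f †) ⊕R (g †))
    ⊕R-† f g (inj₁ a) (inj₁ a′) = refl
    ⊕R-† f g (inj₂ b) (inj₂ b′) = refl
    ⊕R-† f g (inj₁ a) (inj₂ b)  = *-zero
    ⊕R-† f g (inj₂ b) (inj₁ a)  = *-zero

    ⊕R-commute : {f f′ : Hom A A} {g g′ : Hom B B} →
                 Commute (f ⊕R g) (f′ ⊕R g′) ⇔ (Commute f f′ × Commute g g′)
    ⊕R-commute {f} {f′} {g} {g′} = mk⇔
      (λ c → let blocks = ≐-trans (≐-sym (⊕R-∘R f′ f g′ g)) (≐-trans c (⊕R-∘R f f′ g g′))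
             in (λ a a′ → blocks (inj₁ a) (inj₁ a′)) , (λ b b′ → blocks (inj₂ b) (inj₂ b′)))
      (λ (cA , cB) → ≐-trans (⊕R-∘R f′ f g′ g)
                       (≐-trans (⊕R-cong cA cB) (≐-sym (⊕R-∘R f f′ g g′))))

    projA : Hom (A ⊎ B) (A ⊎ B)
    projA = idR A ⊕R zeroR

    blockA : Hom (A ⊎ B) (A ⊎ B) → Hom A A
    blockA h a a′ = h (inj₁ a) (inj₁ a′)

    blockB : Hom (A ⊎ B) (A ⊎ B) → Hom B B
    blockB h b b′ = h (inj₂ b) (inj₂ b′)

    ∘R-projA-inj₁ : ∀ (h : Hom (A ⊎ B) (A ⊎ B)) a z → (h ∘R projA) (inj₁ a) z ≡ h (inj₁ a) z
    ∘R-projA-inj₁ h a z =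
      trans (⋁-inj₁ _ (λ _ → ·-zeroˡ _)) (⋁-idR-· (λ a′ → h (inj₁ a′) z) a)

    ∘R-projA-inj₂ : ∀ (h : Hom (A ⊎ B) (A ⊎ B)) b z → (h ∘R projA) (inj₂ b) z ≡ 0Q
    ∘R-projA-inj₂ h b z = ⋁-zero _ λ { (inj₁ _) → ·-zeroˡ _ ; (inj₂ _) → ·-zeroˡ _ }

    projA-∘R-inj₁ : ∀ (h : Hom (A ⊎ B) (A ⊎ B)) x a → (projA ∘R h) x (inj₁ a) ≡ h x (inj₁ a)
    projA-∘R-inj₁ h x a =
      trans (⋁-inj₁ _ (λ _ → ·-zeroʳ _)) (⋁-·-idR (λ a′ → h x (inj₁ a′)) a)

    projA-∘R-inj₂ : ∀ (h : Hom (A ⊎ B) (A ⊎ B)) x b → (projA ∘R h) x (inj₂ b) ≡ 0Q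
    projA-∘R-inj₂ h x b = ⋁-zero _ λ { (inj₁ _) → ·-zeroʳ _ ; (inj₂ _) → ·-zeroʳ _ }

    commute-projA⇒blockDiagonal : ∀ {h} → Commute h projA → h ≐ (blockA h ⊕R blockB h)
    commute-projA⇒blockDiagonal h∘p≐p∘h (inj₁ a) (inj₁ a′) = refl
    commute-projA⇒blockDiagonal h∘p≐p∘h (inj₂ b) (inj₂ b′) = refl
    commute-projA⇒blockDiagonal {h} h∘p≐p∘h (inj₁ a) (inj₂ b) = begin
      h (inj₁ a) (inj₂ b)             ≡⟨ ∘R-projA-inj₁ h a (inj₂ b) ⟨
      (h ∘R projA) (inj₁ a) (inj₂ b)  ≡⟨ h∘p≐p∘h (inj₁ a) (inj₂ b) ⟩
      (projA ∘R h) (inj₁ a) (inj₂ b)  ≡⟨ projA-∘R-inj₂ h (inj₁ a) b ⟩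
      0Q                              ∎
    commute-projA⇒blockDiagonal {h} h∘p≐p∘h (inj₂ b) (inj₁ a) = begin
      h (inj₂ b) (inj₁ a)             ≡⟨ projA-∘R-inj₁ h (inj₂ b) a ⟨
      (projA ∘R h) (inj₂ b) (inj₁ a)  ≡⟨ h∘p≐p∘h (inj₂ b) (inj₁ a) ⟨
      (h ∘R projA) (inj₂ b) (inj₁ a)  ≡⟨ ∘R-projA-inj₂ h b (inj₁ a) ⟩
      0Q                              ∎

module Commutants (Q : Quantale) where
  open RelQ Q
  open RelationProperties Q

  infix 4 _⇔S_
  _⇔S_ : {X : Set} → Subset X → Subset X → Set
  D ⇔S E = ∀ f → D f ⇔ E f

  ′-cong : ∀ {X : Set} {D E : Subset X} → D ⇔S E → (D ′) ⇔S (E ′)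
  ′-cong D⇔E f = mk⇔
    (λ f∈D′ g g∈E → f∈D′ g (Equivalence.from (D⇔E g) g∈E))
    (λ f∈E′ g g∈D → f∈E′ g (Equivalence.to (D⇔E g) g∈D))

  ⊕S-cong : ∀ {A B : Set} {D D′ : Subset A} {E E′ : Subset B} →
            D ⇔S D′ → E ⇔S E′ → (D ⊕S E) ⇔S (D′ ⊕S E′)
  ⊕S-cong D⇔D′ E⇔E′ h = mk⇔
    (λ (f , g , f∈D , g∈E , h≐) →
       f , g , Equivalence.to (D⇔D′ f) f∈D , Equivalence.to (E⇔E′ g) g∈E , h≐)
    (λ (f , g , f∈D′ , g∈E′ , h≐) →
       f , g , Equivalence.from (D⇔D′ f) f∈D′ , Equivalence.from (E⇔E′ g) g∈E′ , h≐)

  ⊕S-commutant : ∀ {A B : Set} {D : Subset A} {E : Subset B} →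
                 D (idR A) → D zeroR → E zeroR → ((D ⊕S E) ′) ⇔S ((D ′) ⊕S (E ′))
  ⊕S-commutant {D = D} {E} idR∈D zeroR∈D zeroR∈E h = mk⇔ to from
    where
    to : ((D ⊕S E) ′) h → ((D ′) ⊕S (E ′)) h
    to h′ = blockA h , blockB h , blockA′ , blockB′ , blocks
      where
      blocks : h ≐ (blockA h ⊕R blockB h)
      blocks = commute-projA⇒blockDiagonal
                 (h′ projA (idR _ , zeroR , idR∈D , zeroR∈E , λ _ _ → refl))

      commute-blocks : ∀ {f g} → (D ⊕S E) (f ⊕R g) → Commute (blockA h) f × Commute (blockB h) g
      commute-blocks f⊕g∈ = Equivalence.to ⊕R-commute
        (Commute-resp blocks (λ _ _ → refl) (h′ _ f⊕g∈))

      blockA′ : (D ′) (blockA h)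
      blockA′ f f∈D = proj₁ (commute-blocks (f , zeroR , f∈D , zeroR∈E , λ _ _ → refl))

      blockB′ : (E ′) (blockB h)
      blockB′ g g∈E = proj₂ (commute-blocks (zeroR , g , zeroR∈D , g∈E , λ _ _ → refl))

    from : ((D ′) ⊕S (E ′)) h → ((D ⊕S E) ′) h
    from (f , g , f∈D′ , g∈E′ , h≐) k (f′ , g′ , f′∈D , g′∈E , k≐) =
      Commute-resp (≐-sym h≐) (≐-sym k≐)
        (Equivalence.from ⊕R-commute (f∈D′ f′ f′∈D , g∈E′ g′ g′∈E))

lemma33 : (Q : Quantale) (A B : Set) (𝐀 : RelQ.Subset Q A) (𝐁 : RelQ.Subset Q B) →
    RelQ.IsVNAlg Q A 𝐀 → RelQ.IsVNAlg Q B 𝐁 →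
    RelQ.IsVNAlg Q (A ⊎ B) (RelQ._⊕S_ Q 𝐀 𝐁)
lemma33 Q A B 𝐀 𝐁 vA vB = record
  { has-zero    = zeroR , zeroR , 𝔸.has-zero , 𝔹.has-zero , ⊕R-zeroR
  ; has-id      = idR A , idR B , 𝔸.has-id , 𝔹.has-id , ⊕R-idR
  ; ∨-closed    = λ { _ _ (f , g , f∈ , g∈ , ≐₁) (f′ , g′ , f′∈ , g′∈ , ≐₂) →
      f ∨R f′ , g ∨R g′ , 𝔸.∨-closed f f′ f∈ f′∈ , 𝔹.∨-closed g g′ g∈ g′∈ ,
      ≐-trans (∨R-cong ≐₁ ≐₂) (⊕R-∨R f f′ g g′) }
  ; ∘-closed    = λ { _ _ (f , g , f∈ , g∈ , ≐₁) (f′ , g′ , f′∈ , g′∈ , ≐₂) →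
      f′ ∘R f , g′ ∘R g , 𝔸.∘-closed f f′ f∈ f′∈ , 𝔹.∘-closed g g′ g∈ g′∈ ,
      ≐-trans (∘R-cong ≐₁ ≐₂) (⊕R-∘R f f′ g g′) }
  ; ⊙-closed    = λ { q _ (f , g , f∈ , g∈ , h≐) →
      q ⊙ f , q ⊙ g , 𝔸.⊙-closed q f f∈ , 𝔹.⊙-closed q g g∈ ,
      ≐-trans (⊙-cong q h≐) (⊕R-⊙ q f g) }
  ; †-closed    = λ { _ (f , g , f∈ , g∈ , h≐) →
      f † , g † , 𝔸.†-closed f f∈ , 𝔹.†-closed g g∈ , ≐-trans (†-cong h≐) (⊕R-† f g) }
  ; commutative = λ { _ _ (f , g , f∈ , g∈ , ≐₁) (f′ , g′ , f′∈ , g′∈ , ≐₂) →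
      Commute-resp (≐-sym ≐₂) (≐-sym ≐₁)
        (Equivalence.from ⊕R-commute (𝔸.commutative f f′ f∈ f′∈ , 𝔹.commutative g g′ g∈ g′∈)) }
  ; bicommutant = λ h → ⇔-sym (C″⇔C h)
  }
  where
  open RelQ Q
  open RelationProperties Q
  open Commutants Q
  module 𝔸 = IsVNAlg vA
  module 𝔹 = IsVNAlg vB

  C″⇔C : ((𝐀 ⊕S 𝐁) ′) ′ ⇔S (𝐀 ⊕S 𝐁)
  C″⇔C h =
    ⊕S-cong (λ f → ⇔-sym (𝔸.bicommutant f)) (λ g → ⇔-sym (𝔹.bicommutant g)) h
    ⇔-∘ (⊕S-commutant (λ g _ → idR-commute g) (λ g _ → zeroR-commute g) (λ g _ → zeroR-commute g) h
    ⇔-∘ ′-cong (⊕S-commutant 𝔸.has-id 𝔸.has-zero 𝔹.has-zero) h)
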